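{- Let $m,n\ge 3$ be integers. The Cartesian product $C_m\times C_n$ of the cycles $C_m$ and $C_n$ contains a parallel total perfect code if and only if $m$ and $n$ are both multiples of $4$.
   Context: $C_m\times C_n$ is the graph with vertex set $\mathbb{Z}_m\times\mathbb{Z}_n$ in which two vertices are adjacent iff they agree in one coordinate and differ by $\pm1$ in the other. A perfect dominating set (PDS) of a graph $G$ is a vertex set $S$ such that every vertex not in $S$ is adjacent to exactly one vertex of $S$. A total perfect code (TPC) is a PDS $S$ such that every connected component of the subgraph induced by $S$ is a single edge (a 1-cube). A TPC is parallel (a PTPC) if these edges are pairwise parallel, i.e. all of them lie in the same coordinate direction. -}

module Defs where

open import Data.Nat using (ℕ; zero; suc)
open import Data.Fin using (Fin; toℕ)
open import Data.Product using (Σ; ∃; _×_; _,_)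
open import Data.Sum using (_⊎_)
open import Relation.Binary.PropositionalEquality using (_≡_)
open import Relation.Nullary using (¬_)
open import Data.Bool using (Bool; true)

CycAdj : (m : ℕ) → Fin m → Fin m → Set
CycAdj m i j =
  (suc (toℕ i) ≡ toℕ j) ⊎ (suc (toℕ j) ≡ toℕ i)
  ⊎ ((suc (toℕ i) ≡ m) × (toℕ j ≡ 0))
  ⊎ ((suc (toℕ j) ≡ m) × (toℕ i ≡ 0))

V : ℕ → ℕ → Set
V m n = Fin m × Fin n

Adj₁ : (m n : ℕ) → V m n → V m n → Set
Adj₁ m n (a , b) (c , d) = CycAdj m a c × (b ≡ d)

Adj₂ : (m n : ℕ) → V m n → V m n → Set
Adj₂ m n (a , b) (c , d) = (a ≡ c) × CycAdj n b d

Adj : (m n : ℕ) → V m n → V m n → Set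
Adj m n u v = Adj₁ m n u v ⊎ Adj₂ m n u v

ExactlyOneNbrIn : (m n : ℕ) → (V m n → Bool) → V m n → Set
ExactlyOneNbrIn m n S v =
  Σ (V m n) λ u → S u ≡ true × Adj m n v u × (∀ w → S w ≡ true → Adj m n v w → w ≡ u)

IsPDS : (m n : ℕ) → (V m n → Bool) → Set
IsPDS m n S = ∀ v → ¬ (S v ≡ true) → ExactlyOneNbrIn m n S v

-- Total perfect code: a PDS whose induced subgraph has all components single edges,
-- i.e. every vertex of S has exactly one neighbour in S.
IsTPC : (m n : ℕ) → (V m n → Bool) → Set
IsTPC m n S = IsPDS m n S × (∀ v → S v ≡ true → ExactlyOneNbrIn m n S v)

IsPTPC : (m n : ℕ) → (V m n → Bool) → Set
IsPTPC m n S = IsTPC m n S ×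
  ((∀ u w → S u ≡ true → S w ≡ true → Adj m n u w → Adj₁ m n u w)
   ⊎ (∀ u w → S u ≡ true → S w ≡ true → Adj m n u w → Adj₂ m n u w))

HasPTPC : ℕ → ℕ → Set
HasPTPC m n = Σ (V m n → Bool) λ S → IsPTPC m n S

module Submission where

-- Necessity is double counting. Transposing if necessary, the code edges are
-- horizontal. Let F x y ∈ {0,1} be the indicator of the code, periodic on ℤ². Every
-- vertex has exactly one code neighbour; summing this along row y + 1 shows that the
-- row sums r satisfy r y + 2 r (y+1) + r (y+2) = m. A periodic sequence with constant
-- such "second sums" has constant pair sums r y + r (y+1) (pair-sums-constant), so
-- m = 2 (r 0 + r 1); each row sum is even since code vertices pair up horizontally,
-- hence 4 ∣ m. The column sums t obey the same recurrence with n, and t (x+1) splits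
-- as p x + p (x+1), p x counting code edges between columns x and x+1. Applying
-- pair-sums-constant to t (x+1) and then to p shows t (x+1) is constant, so n = 4 t 1.
-- Sufficiency: the 4-periodic motif with code edges {(0,0),(1,0)}, {(2,2),(3,2)},
-- checked on residues modulo 4.

open import Defs
open import Data.Nat using (ℕ; _≤_)
open import Data.Nat.Divisibility using (_∣_)
open import Data.Product using (_×_)
open import Function.Bundles using (_⇔_)

open import Data.Bool using (Bool; true; false)
open import Data.Bool.Properties using (¬-not; not-¬)
open import Data.Empty using (⊥-elim)
open import Data.Fin using (Fin; toℕ; fromℕ<)
open import Data.Fin.Properties using (toℕ-fromℕ<; toℕ-injective; toℕ<n)
open import Data.Nat using (zero; suc; _+_; _*_; _<_; z≤n; s≤s; NonZero)
open import Data.Nat.DivMod using (_%_; m%n<n; n%n≡0; [m+n]%n≡m%n; [m+kn]%n≡m%n; m<n⇒m%n≡m; m≡m%n+[m/n]*n; %-distribˡ-+; m∣n⇒o%n%m≡o%m; _/_)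
open import Data.Nat.Divisibility using (divides)
open import Data.Nat.Properties
open import Data.Nat.Tactic.RingSolver using (solve-∀)
open import Data.Product using (Σ; _,_; proj₁; proj₂; swap)
open import Data.Sum using (_⊎_; inj₁; inj₂)
open import Function.Base using (_∘_)
open import Function.Bundles using (mk⇔)
open import Relation.Binary.PropositionalEquality
open import Relation.Nullary using (¬_)

-- Finite sums and periodic sequences.

∑< : ℕ → (ℕ → ℕ) → ℕ
∑< zero    g = 0
∑< (suc k) g = ∑< k g + g k

Periodic : ℕ → (ℕ → ℕ) → Set
Periodic P g = ∀ x → g (x + P) ≡ g x

sum-cong : ∀ {g h : ℕ → ℕ} → (∀ x → g x ≡ h x) → ∀ k → ∑< k g ≡ ∑< k h
sum-cong e zero    = refl
sum-cong e (suc k) = cong₂ _+_ (sum-cong e k) (e k)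

sum-+ : ∀ (g h : ℕ → ℕ) k → ∑< k (λ x → g x + h x) ≡ ∑< k g + ∑< k h
sum-+ g h zero    = refl
sum-+ g h (suc k) = trans (cong (_+ (g k + h k)) (sum-+ g h k))
                          (interchange (∑< k g) (∑< k h) (g k) (h k))
  where
  interchange : ∀ a b c d → (a + b) + (c + d) ≡ (a + c) + (b + d)
  interchange = solve-∀

sum-ones : ∀ k → ∑< k (λ _ → 1) ≡ k
sum-ones zero    = refl
sum-ones (suc k) = trans (cong (_+ 1) (sum-ones k)) (+-comm k 1)

sum-shift-window : ∀ (g : ℕ → ℕ) k → ∑< k (g ∘ suc) + g 0 ≡ ∑< k g + g k
sum-shift-window g zero    = refl
sum-shift-window g (suc k) = begin
  ∑< k (g ∘ suc) + g (suc k) + g 0   ≡⟨ swap-last (∑< k (g ∘ suc)) (g (suc k)) (g 0) ⟩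
  ∑< k (g ∘ suc) + g 0 + g (suc k)   ≡⟨ cong (_+ g (suc k)) (sum-shift-window g k) ⟩
  ∑< k g + g k + g (suc k)           ∎
  where
  open ≡-Reasoning
  swap-last : ∀ a b c → a + b + c ≡ a + c + b
  swap-last = solve-∀

sum-rotate₁ : ∀ (g : ℕ → ℕ) k → g k ≡ g 0 → ∑< k (g ∘ suc) ≡ ∑< k g
sum-rotate₁ g k e = +-cancelʳ-≡ _ _ _ (trans (sum-shift-window g k) (cong (∑< k g +_) e))

sum-rotate : ∀ (g : ℕ → ℕ) k → Periodic k g → ∀ j → ∑< k (λ x → g (x + j)) ≡ ∑< k g
sum-rotate g k per zero    = sum-cong (λ x → cong g (+-identityʳ x)) k
sum-rotate g k per (suc j) = begin
  ∑< k (λ x → g (x + suc j))    ≡⟨ sum-cong (λ x → cong g (+-suc x j)) k ⟩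
  ∑< k (λ x → g (suc x + j))    ≡⟨ sum-rotate₁ (λ x → g (x + j)) k (trans (cong g (+-comm k j)) (per j)) ⟩
  ∑< k (λ x → g (x + j))        ≡⟨ sum-rotate g k per j ⟩
  ∑< k g                        ∎
  where open ≡-Reasoning

linear-growth : ∀ (h : ℕ → ℕ) a b → (∀ k → h (suc k) + a ≡ h k + b) →
                ∀ k → h k + k * a ≡ h 0 + k * b
linear-growth h a b step zero    = refl
linear-growth h a b step (suc k) = begin
  h (suc k) + (a + k * a)   ≡⟨ sym (+-assoc (h (suc k)) a (k * a)) ⟩
  h (suc k) + a + k * a     ≡⟨ cong (_+ k * a) (step k) ⟩
  h k + b + k * a           ≡⟨ rearrange (h k) b (k * a) ⟩
  (h k + k * a) + b         ≡⟨ cong (_+ b) (linear-growth h a b step k) ⟩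
  h 0 + k * b + b           ≡⟨ regroup (h 0) (k * b) b ⟩
  h 0 + (b + k * b)         ∎
  where
  open ≡-Reasoning
  rearrange : ∀ x y z → x + y + z ≡ x + z + y
  rearrange = solve-∀
  regroup : ∀ x y z → x + y + z ≡ x + (z + y)
  regroup = solve-∀

periodic-step : ∀ (h : ℕ → ℕ) a b P → (∀ k → h (suc k) + a ≡ h k + b) →
                h (suc P) ≡ h 0 → a ≡ b
periodic-step h a b P step back = *-cancelˡ-≡ a b (suc P)
  (+-cancelˡ-≡ (h 0) _ _
    (trans (cong (_+ suc P * a) (sym back)) (linear-growth h a b step (suc P))))

two-periodic : ∀ (b : ℕ → ℕ) → (∀ y → b (suc (suc y)) ≡ b y) →
               ∀ k → (b (k + k) ≡ b 0) × (b (suc (k + k)) ≡ b 1)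
two-periodic b per₂ zero    = refl , refl
two-periodic b per₂ (suc k) rewrite +-suc k k =
  trans (per₂ (k + k)) (proj₁ (two-periodic b per₂ k)) ,
  trans (per₂ (suc (k + k))) (proj₂ (two-periodic b per₂ k))

-- The even terms c (2k)
-- then move by a constant step, which periodicity forces to be zero.
pair-sums-constant : ∀ (c : ℕ → ℕ) P K → Periodic (suc P) c →
  (∀ y → (c y + c (suc y)) + (c (suc y) + c (suc (suc y))) ≡ K) →
  ∀ y → c y + c (suc y) ≡ c 0 + c 1
pair-sums-constant c P K per second = constant
  where
  open ≡-Reasoning
  -- The pair sums; by hypothesis b y + b (y+1) = K, so b has period 2.
  b : ℕ → ℕ
  b y = c y + c (suc y)

  b-per₂ : ∀ y → b (suc (suc y)) ≡ b y
  b-per₂ y = +-cancelˡ-≡ (b (suc y)) _ _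
    (trans (second (suc y)) (trans (sym (second y)) (+-comm (b y) (b (suc y)))))

  -- c (2k + 2) - c (2k) = b (2k + 1) - b (2k) = b 1 - b 0.
  even-step : ∀ k → c (suc k + suc k) + b 0 ≡ c (k + k) + b 1
  even-step k = begin
    c (suc k + suc k) + b 0                        ≡⟨ cong₂ (λ z w → c z + w) (cong suc (+-suc k k))
                                                            (sym (proj₁ (two-periodic b b-per₂ k))) ⟩
    c (suc (suc (k + k))) + b (k + k)              ≡⟨ rotate (c (suc (suc (k + k)))) (c (k + k)) (c (suc (k + k))) ⟩
    c (k + k) + b (suc (k + k))                    ≡⟨ cong (c (k + k) +_) (proj₂ (two-periodic b b-per₂ k)) ⟩
    c (k + k) + b 1                                ∎
    where
    rotate : ∀ x y z → x + (y + z) ≡ y + (z + x)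
    rotate = solve-∀

  b₀≡b₁ : b 0 ≡ b 1
  b₀≡b₁ = periodic-step (λ k → c (k + k)) (b 0) (b 1) P even-step
            (trans (per (suc P)) (per 0))

  constant : ∀ y → b y ≡ b 0
  constant zero          = refl
  constant (suc zero)    = sym b₀≡b₁
  constant (suc (suc y)) = trans (b-per₂ y) (constant y)

second-sum-value : ∀ (c : ℕ → ℕ) P K → Periodic (suc P) c →
  (∀ y → (c y + c (suc y)) + (c (suc y) + c (suc (suc y))) ≡ K) →
  K ≡ (c 0 + c 1) + (c 0 + c 1)
second-sum-value c P K per second =
  trans (sym (second 0)) (cong ((c 0 + c 1) +_) (pair-sums-constant c P K per second 1))

-- Counting on the discrete torus.

-- The weight of F on the four lattice neighbours x ± 1, y ± 1 of (x , y), where F has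
-- periods m' + 1 and n' + 1 and x - 1, y - 1 are represented by x + m', y + n'.
NeighbourSum : (ℕ → ℕ → ℕ) → ℕ → ℕ → ℕ → ℕ → ℕ
NeighbourSum F m' n' x y = (F (suc x) y + F (x + m') y) + (F x (suc y) + F x (y + n'))

module TorusCount (F : ℕ → ℕ → ℕ) (m' n' : ℕ)
  (per-x : ∀ y → Periodic (suc m') (λ x → F x y))
  (per-y : ∀ x → Periodic (suc n') (F x))
  (one : ∀ x y → NeighbourSum F m' n' x y ≡ 1) where

  r : ℕ → ℕ
  r y = ∑< (suc m') (λ x → F x y)

  r-periodic : Periodic (suc n') r
  r-periodic y = sum-cong (λ x → per-y x y) (suc m')

  -- Summing the neighbour condition along row y + 1 gives r y + 2 r (y+1) + r (y+2) = m.
  row-recurrence : ∀ y → (r y + r (suc y)) + (r (suc y) + r (suc (suc y))) ≡ suc m'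
  row-recurrence y = begin
    (r y + r (suc y)) + (r (suc y) + r (suc (suc y)))
      ≡⟨ regroup (r y) (r (suc y)) (r (suc (suc y))) ⟩
    (r (suc y) + r (suc y)) + (r (suc (suc y)) + r y)
      ≡⟨ sym (cong₂ _+_ (cong₂ _+_ right left) (cong (r (suc (suc y)) +_) below)) ⟩
    (∑< m (λ x → F (suc x) (suc y)) + ∑< m (λ x → F (x + m') (suc y)))
      + (∑< m (λ x → F x (suc (suc y))) + ∑< m (λ x → F x (suc y + n')))
      ≡⟨ sym (cong₂ _+_ (sum-+ _ _ m) (sum-+ _ _ m)) ⟩
    ∑< m (λ x → F (suc x) (suc y) + F (x + m') (suc y))
      + ∑< m (λ x → F x (suc (suc y)) + F x (suc y + n'))
      ≡⟨ sym (sum-+ _ _ m) ⟩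
    ∑< m (λ x → NeighbourSum F m' n' x (suc y))
      ≡⟨ sum-cong (λ x → one x (suc y)) m ⟩
    ∑< m (λ _ → 1)
      ≡⟨ sum-ones m ⟩
    m ∎
    where
    open ≡-Reasoning
    m : ℕ
    m = suc m'
    regroup : ∀ a b c → (a + b) + (b + c) ≡ (b + b) + (c + a)
    regroup = solve-∀
    right : ∑< m (λ x → F (suc x) (suc y)) ≡ r (suc y)
    right = sum-rotate₁ (λ x → F x (suc y)) m (per-x (suc y) 0)
    left : ∑< m (λ x → F (x + m') (suc y)) ≡ r (suc y)
    left = sum-rotate (λ x → F x (suc y)) m (per-x (suc y)) m'
    below : ∑< m (λ x → F x (suc y + n')) ≡ r y
    below = sum-cong (λ x → trans (cong (F x) (sym (+-suc y n'))) (per-y x y)) m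

-- If moreover every point of weight 1 has total weight 1 on its two horizontal
-- neighbours (the code edges are horizontal), then both periods are multiples of 4.
module HorizontalPairing (F : ℕ → ℕ → ℕ) (m' n' : ℕ)
  (per-x : ∀ y → Periodic (suc m') (λ x → F x y))
  (per-y : ∀ x → Periodic (suc n') (F x))
  (one : ∀ x y → NeighbourSum F m' n' x y ≡ 1)
  (paired : ∀ x y → F x y * (F (suc x) y + F (x + m') y) ≡ F x y) where

  open TorusCount F m' n' per-x per-y one using (r; r-periodic; row-recurrence)

  -- Column sums are the row sums of the transposed weight.
  module Columns = TorusCount (λ y x → F x y) n' m' per-y per-x
                              (λ y x → trans (+-comm (F x (suc y) + F x (y + n')) _) (one x y))

  edge : ℕ → ℕ → ℕ
  edge x y = F x y * F (suc x) y

  edge-periodic : ∀ y → Periodic (suc m') (λ x → edge x y)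
  edge-periodic y x = cong₂ _*_ (per-x y x) (per-x y (suc x))

  weight-split : ∀ x y → F x y ≡ edge x y + edge (x + m') y
  weight-split x y = begin
    F x y                                         ≡⟨ sym (paired x y) ⟩
    F x y * (F (suc x) y + F (x + m') y)          ≡⟨ *-distribˡ-+ (F x y) _ _ ⟩
    edge x y + F x y * F (x + m') y               ≡⟨ cong (edge x y +_) (*-comm (F x y) _) ⟩
    edge x y + F (x + m') y * F x y               ≡⟨ cong (λ z → edge x y + F (x + m') y * z) (sym wrap-around) ⟩
    edge x y + edge (x + m') y                    ∎
    where
    open ≡-Reasoning
    wrap-around : F (suc (x + m')) y ≡ F x y
    wrap-around = trans (cong (λ z → F z y) (sym (+-suc x m'))) (per-x y x)

  rowEdges : ℕ → ℕ
  rowEdges y = ∑< (suc m') (λ x → edge x y)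

  columnEdges : ℕ → ℕ
  columnEdges x = ∑< (suc n') (edge x)

  row-even : ∀ y → r y ≡ rowEdges y + rowEdges y
  row-even y = trans (sum-cong (λ x → weight-split x y) (suc m'))
    (trans (sum-+ (λ x → edge x y) (λ x → edge (x + m') y) (suc m'))
           (cong (rowEdges y +_) (sum-rotate (λ x → edge x y) (suc m') (edge-periodic y) m')))

  column-split : ∀ x → Columns.r (suc x) ≡ columnEdges x + columnEdges (suc x)
  column-split x = trans (sum-cong (λ y → weight-split (suc x) y) (suc n'))
    (trans (sum-+ (edge (suc x)) (edge (suc x + m')) (suc n'))
           (trans (cong (columnEdges (suc x) +_) previous) (+-comm (columnEdges (suc x)) _)))
    where
    previous : columnEdges (suc x + m') ≡ columnEdges x
    previous = sum-cong (λ y → trans (cong (λ z → edge z y) (sym (+-suc x m')))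
                                     (edge-periodic y x)) (suc n')

  four-∣-m : 4 ∣ suc m'
  four-∣-m = divides (rowEdges 0 + rowEdges 1) (begin
    suc m'                    ≡⟨ second-sum-value r n' (suc m') r-periodic row-recurrence ⟩
    (r 0 + r 1) + (r 0 + r 1) ≡⟨ cong₂ (λ a b → (a + b) + (a + b)) (row-even 0) (row-even 1) ⟩
    ((rowEdges 0 + rowEdges 0) + (rowEdges 1 + rowEdges 1))
      + ((rowEdges 0 + rowEdges 0) + (rowEdges 1 + rowEdges 1))
                              ≡⟨ times-four (rowEdges 0) (rowEdges 1) ⟩
    (rowEdges 0 + rowEdges 1) * 4 ∎)
    where
    open ≡-Reasoning
    times-four : ∀ a b → ((a + a) + (b + b)) + ((a + a) + (b + b)) ≡ (a + b) * 4
    times-four = solve-∀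

  -- With T x = t (x + 1) for the column sums t: T has constant pair sums, hence so
  -- do the column edge counts, hence T is constant and n = 4 T 0.
  four-∣-n : 4 ∣ suc n'
  four-∣-n = divides (T 0) (begin
    suc n'                    ≡⟨ second-sum-value T m' (suc n') T-periodic T-recurrence ⟩
    (T 0 + T 1) + (T 0 + T 1) ≡⟨ cong (λ z → (T 0 + z) + (T 0 + z)) (T-constant 1) ⟩
    (T 0 + T 0) + (T 0 + T 0) ≡⟨ times-four (T 0) ⟩
    T 0 * 4                   ∎)
    where
    open ≡-Reasoning
    times-four : ∀ a → (a + a) + (a + a) ≡ a * 4
    times-four = solve-∀
    T : ℕ → ℕ
    T x = Columns.r (suc x)
    T-periodic : Periodic (suc m') T
    T-periodic x = Columns.r-periodic (suc x)
    T-recurrence : ∀ x → (T x + T (suc x)) + (T (suc x) + T (suc (suc x))) ≡ suc n'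
    T-recurrence x = Columns.row-recurrence (suc x)
    columnEdges-periodic : Periodic (suc m') columnEdges
    columnEdges-periodic x = sum-cong (λ y → edge-periodic y x) (suc n')
    columnEdges-recurrence : ∀ x → (columnEdges x + columnEdges (suc x))
      + (columnEdges (suc x) + columnEdges (suc (suc x))) ≡ T 0 + T 1
    columnEdges-recurrence x =
      trans (sym (cong₂ _+_ (column-split x) (column-split (suc x))))
            (pair-sums-constant T m' (suc n') T-periodic T-recurrence x)
    T-constant : ∀ x → T x ≡ T 0
    T-constant x = trans (column-split x)
      (trans (pair-sums-constant columnEdges m' (T 0 + T 1) columnEdges-periodic columnEdges-recurrence x)
             (sym (column-split 0)))

-- The cycle C_m.

Follows : (m : ℕ) → Fin m → Fin m → Set
Follows m i j = (suc (toℕ i) ≡ toℕ j) ⊎ ((suc (toℕ i) ≡ m) × (toℕ j ≡ 0))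

follows⇒adj : ∀ {m i j} → Follows m i j → CycAdj m i j
follows⇒adj (inj₁ e) = inj₁ e
follows⇒adj (inj₂ e) = inj₂ (inj₂ (inj₁ e))

preceded⇒adj : ∀ {m i j} → Follows m j i → CycAdj m i j
preceded⇒adj (inj₁ e) = inj₂ (inj₁ e)
preceded⇒adj (inj₂ e) = inj₂ (inj₂ (inj₂ e))

adj⇒follows : ∀ {m i j} → CycAdj m i j → Follows m i j ⊎ Follows m j i
adj⇒follows (inj₁ e)                = inj₁ (inj₁ e)
adj⇒follows (inj₂ (inj₁ e))         = inj₂ (inj₁ e)
adj⇒follows (inj₂ (inj₂ (inj₁ e)))  = inj₁ (inj₂ e)
adj⇒follows (inj₂ (inj₂ (inj₂ e)))  = inj₂ (inj₂ e)

follows-functional : ∀ {m i j j'} → Follows m i j → Follows m i j' → j ≡ j'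
follows-functional (inj₁ e) (inj₁ e')         = toℕ-injective (trans (sym e) e')
follows-functional {j = j} (inj₁ e) (inj₂ (e' , _))   = ⊥-elim (<-irrefl (trans (sym e) e') (toℕ<n j))
follows-functional {j' = j'} (inj₂ (e , _)) (inj₁ e') = ⊥-elim (<-irrefl (trans (sym e') e) (toℕ<n j'))
follows-functional (inj₂ (_ , z)) (inj₂ (_ , z')) = toℕ-injective (trans z (sym z'))

follows-injective : ∀ {m i i' j} → Follows m i j → Follows m i' j → i ≡ i'
follows-injective (inj₁ e) (inj₁ e')         = toℕ-injective (suc-injective (trans e (sym e')))
follows-injective (inj₁ e) (inj₂ (_ , z))    with () ← trans e z
follows-injective (inj₂ (_ , z)) (inj₁ e')   with () ← trans e' z
follows-injective (inj₂ (e , _)) (inj₂ (e' , _)) = toℕ-injective (suc-injective (trans e (sym e')))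

follows-irrefl : ∀ {m i} → 2 ≤ m → ¬ Follows m i i
follows-irrefl _ (inj₁ e)                  = 1+n≢n e
follows-irrefl 2≤m (inj₂ (e , z)) = ≤⇒≯ (subst (_≤ 1) (trans (cong suc (sym z)) e) ≤-refl) 2≤m

follows-asym : ∀ {m i j} → 3 ≤ m → Follows m i j → ¬ Follows m j i
follows-asym {i = i} _ (inj₁ e) (inj₁ e') = no-2-cycle (trans (cong suc e) e')
  where
  no-2-cycle : ∀ {k} → suc (suc k) ≢ k
  no-2-cycle {suc k} eq = no-2-cycle (suc-injective eq)
follows-asym 3≤m (inj₁ e) (inj₂ (e' , z)) =
  ≤⇒≯ (subst (_≤ 2) (trans (sym (cong suc (trans (sym e) (cong suc z)))) e') ≤-refl) 3≤m
follows-asym 3≤m (inj₂ (e , z)) (inj₁ e') =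
  ≤⇒≯ (subst (_≤ 2) (trans (sym (cong suc (trans (sym e') (cong suc z)))) e) ≤-refl) 3≤m
follows-asym 3≤m (inj₂ (e , z)) (inj₂ (_ , z')) =
  ≤⇒≯ (subst (_≤ 2) (trans (cong suc (sym z')) e) (s≤s z≤n)) 3≤m

wrap : ∀ {m'} → ℕ → Fin (suc m')
wrap {m'} x = fromℕ< (m%n<n x (suc m'))

toℕ-wrap : ∀ {m'} x → toℕ (wrap {m'} x) ≡ x % suc m'
toℕ-wrap {m'} x = toℕ-fromℕ< (m%n<n x (suc m'))

wrap-periodic : ∀ {m'} x → wrap {m'} (x + suc m') ≡ wrap x
wrap-periodic {m'} x = toℕ-injective
  (trans (toℕ-wrap (x + suc m')) (trans ([m+n]%n≡m%n x (suc m')) (sym (toℕ-wrap x))))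

wrap-toℕ : ∀ {m'} (a : Fin (suc m')) → wrap (toℕ a) ≡ a
wrap-toℕ a = toℕ-injective (trans (toℕ-wrap (toℕ a)) (m<n⇒m%n≡m (toℕ<n a)))

suc-% : ∀ x n .{{_ : NonZero n}} → suc x % n ≡ suc (x % n) % n
suc-% x n = trans (cong (λ z → suc z % n) (m≡m%n+[m/n]*n x n))
                  ([m+kn]%n≡m%n (suc (x % n)) (x / n) n)

wrap-follows : ∀ {m'} x → Follows (suc m') (wrap {m'} x) (wrap (suc x))
wrap-follows {m'} x with m≤n⇒m<n∨m≡n (m%n<n x (suc m'))
... | inj₁ lt = inj₁ (trans (cong suc (toℕ-wrap x))
                            (sym (trans (toℕ-wrap (suc x)) (trans (suc-% x (suc m')) (m<n⇒m%n≡m lt)))))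
... | inj₂ eq = inj₂ (trans (cong suc (toℕ-wrap x)) eq ,
                      trans (toℕ-wrap (suc x))
                            (trans (suc-% x (suc m')) (trans (cong (_% suc m') eq) (n%n≡0 (suc m')))))

-- x + m' represents x - 1.
wrap-preceded : ∀ {m'} x → Follows (suc m') (wrap {m'} (x + m')) (wrap x)
wrap-preceded {m'} x = subst (Follows (suc m') (wrap (x + m')))
  (trans (cong wrap (sym (+-suc x m'))) (wrap-periodic x)) (wrap-follows (x + m'))

wrap-neighbours : ∀ {m'} x (j : Fin (suc m')) → CycAdj (suc m') (wrap x) j →
                  j ≡ wrap (suc x) ⊎ j ≡ wrap (x + m')
wrap-neighbours x j adj with adj⇒follows adj
... | inj₁ f = inj₁ (follows-functional f (wrap-follows x))
... | inj₂ f = inj₂ (follows-injective f (wrap-preceded x))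

wrap-suc≢ : ∀ {m'} x → 2 ≤ suc m' → wrap {m'} (suc x) ≢ wrap x
wrap-suc≢ x 2≤m e = follows-irrefl 2≤m (subst (Follows _ (wrap x)) e (wrap-follows x))

wrap-pred≢ : ∀ {m'} x → 2 ≤ suc m' → wrap {m'} (x + m') ≢ wrap x
wrap-pred≢ x 2≤m e = follows-irrefl 2≤m (subst (λ z → Follows _ z (wrap x)) e (wrap-preceded x))

wrap-suc≢pred : ∀ {m'} x → 3 ≤ suc m' → wrap {m'} (suc x) ≢ wrap (x + m')
wrap-suc≢pred x 3≤m e =
  follows-asym 3≤m (wrap-follows x) (subst (λ z → Follows _ z (wrap x)) (sym e) (wrap-preceded x))

cyc-irrefl : ∀ {m i} → 2 ≤ m → ¬ CycAdj m i i
cyc-irrefl 2≤m adj with adj⇒follows adj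
... | inj₁ f = follows-irrefl 2≤m f
... | inj₂ f = follows-irrefl 2≤m f

χ : Bool → ℕ
χ true  = 1
χ false = 0

χ-false : ∀ {b} → ¬ b ≡ true → χ b ≡ 0
χ-false b≢true = cong χ (¬-not b≢true)

cong₄ : ∀ {a a' b b' c c' d d' : ℕ} → a ≡ a' → b ≡ b' → c ≡ c' → d ≡ d' →
        (a + b) + (c + d) ≡ (a' + b') + (c' + d')
cong₄ refl refl refl refl = refl

module FourNeighbours {A : Set} (R : A → A → Set) (v w₁ w₂ w₃ w₄ : A)
  (r₁ : R v w₁) (r₂ : R v w₂) (r₃ : R v w₃) (r₄ : R v w₄)
  (only : ∀ w → R v w → w ≡ w₁ ⊎ w ≡ w₂ ⊎ w ≡ w₃ ⊎ w ≡ w₄) (S : A → Bool) where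

  ExactlyOne : Set
  ExactlyOne = Σ A λ u → S u ≡ true × R v u × (∀ w → S w ≡ true → R v w → w ≡ u)

  count : ℕ
  count = (χ (S w₁) + χ (S w₂)) + (χ (S w₃) + χ (S w₄))

  exactlyOne⇒count : w₁ ≢ w₂ → w₁ ≢ w₃ → w₁ ≢ w₄ → w₂ ≢ w₃ → w₂ ≢ w₄ → w₃ ≢ w₄ →
                     ExactlyOne → count ≡ 1
  exactlyOne⇒count d₁₂ d₁₃ d₁₄ d₂₃ d₂₄ d₃₄ (u , Su , ru , unique) = tally (only u ru)
    where
    present : ∀ {w} → u ≡ w → χ (S w) ≡ 1
    present e = cong χ (subst (λ z → S z ≡ true) e Su)

    absent : ∀ {w w'} → R v w → w ≢ w' → u ≡ w' → χ (S w) ≡ 0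
    absent {w} r w≢w' e = χ-false (λ s → w≢w' (trans (unique w s r) e))


    tally : u ≡ w₁ ⊎ u ≡ w₂ ⊎ u ≡ w₃ ⊎ u ≡ w₄ → count ≡ 1
    tally (inj₁ e) =
      cong₄ (present e) (absent r₂ (≢-sym d₁₂) e) (absent r₃ (≢-sym d₁₃) e) (absent r₄ (≢-sym d₁₄) e)
    tally (inj₂ (inj₁ e)) =
      cong₄ (absent r₁ d₁₂ e) (present e) (absent r₃ (≢-sym d₂₃) e) (absent r₄ (≢-sym d₂₄) e)
    tally (inj₂ (inj₂ (inj₁ e))) =
      cong₄ (absent r₁ d₁₃ e) (absent r₂ d₂₃ e) (present e) (absent r₄ (≢-sym d₃₄) e)
    tally (inj₂ (inj₂ (inj₂ e))) =
      cong₄ (absent r₁ d₁₄ e) (absent r₂ d₂₄ e) (absent r₃ d₃₄ e) (present e)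

  count⇒exactlyOne : count ≡ 1 → ExactlyOne
  count⇒exactlyOne = select (S w₁) (S w₂) (S w₃) (S w₄) refl refl refl refl
    where
    Excluded : A → A → Set
    Excluded u w = w ≡ u ⊎ S w ≡ false

    excluded : ∀ {u w} → Excluded u w → S w ≡ true → w ≡ u
    excluded (inj₁ e) _ = e
    excluded (inj₂ f) s with () ← trans (sym s) f

    sole : ∀ {u} → Excluded u w₁ → Excluded u w₂ → Excluded u w₃ → Excluded u w₄ →
           ∀ w → S w ≡ true → R v w → w ≡ u
    sole x₁ x₂ x₃ x₄ w s r with only w r
    ... | inj₁ refl                = excluded x₁ s
    ... | inj₂ (inj₁ refl)         = excluded x₂ s
    ... | inj₂ (inj₂ (inj₁ refl))  = excluded x₃ s
    ... | inj₂ (inj₂ (inj₂ refl))  = excluded x₄ s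

    select : ∀ b₁ b₂ b₃ b₄ → S w₁ ≡ b₁ → S w₂ ≡ b₂ → S w₃ ≡ b₃ → S w₄ ≡ b₄ →
             (χ b₁ + χ b₂) + (χ b₃ + χ b₄) ≡ 1 → ExactlyOne
    select true false false false e₁ e₂ e₃ e₄ _ =
      w₁ , e₁ , r₁ , sole (inj₁ refl) (inj₂ e₂) (inj₂ e₃) (inj₂ e₄)
    select false true false false e₁ e₂ e₃ e₄ _ =
      w₂ , e₂ , r₂ , sole (inj₂ e₁) (inj₁ refl) (inj₂ e₃) (inj₂ e₄)
    select false false true false e₁ e₂ e₃ e₄ _ =
      w₃ , e₃ , r₃ , sole (inj₂ e₁) (inj₂ e₂) (inj₁ refl) (inj₂ e₄)
    select false false false true e₁ e₂ e₃ e₄ _ =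
      w₄ , e₄ , r₄ , sole (inj₂ e₁) (inj₂ e₂) (inj₂ e₃) (inj₁ refl)
    select true  true  _     _     _ _ _ _ ()
    select true  false true  _     _ _ _ _ ()
    select true  false false true  _ _ _ _ ()
    select false true  true  _     _ _ _ _ ()
    select false true  false true  _ _ _ _ ()
    select false false true  true  _ _ _ _ ()
    select false false false false _ _ _ _ ()

-- The torus C_m × C_n.

module Around (m' n' x y : ℕ) where
  v w₁ w₂ w₃ w₄ : V (suc m') (suc n')
  v  = wrap x , wrap y
  w₁ = wrap (suc x) , wrap y
  w₂ = wrap (x + m') , wrap y
  w₃ = wrap x , wrap (suc y)
  w₄ = wrap x , wrap (y + n')

  a₁ : Adj _ _ v w₁
  a₁ = inj₁ (follows⇒adj (wrap-follows x) , refl)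
  a₂ : Adj _ _ v w₂
  a₂ = inj₁ (preceded⇒adj (wrap-preceded x) , refl)
  a₃ : Adj _ _ v w₃
  a₃ = inj₂ (refl , follows⇒adj (wrap-follows y))
  a₄ : Adj _ _ v w₄
  a₄ = inj₂ (refl , preceded⇒adj (wrap-preceded y))

  only : ∀ w → Adj _ _ v w → w ≡ w₁ ⊎ w ≡ w₂ ⊎ w ≡ w₃ ⊎ w ≡ w₄
  only (c , d) (inj₁ (adj , e)) with wrap-neighbours x c adj
  ... | inj₁ q = inj₁ (cong₂ _,_ q (sym e))
  ... | inj₂ q = inj₂ (inj₁ (cong₂ _,_ q (sym e)))
  only (c , d) (inj₂ (e , adj)) with wrap-neighbours y d adj
  ... | inj₁ q = inj₂ (inj₂ (inj₁ (cong₂ _,_ (sym e) q)))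
  ... | inj₂ q = inj₂ (inj₂ (inj₂ (cong₂ _,_ (sym e) q)))

  module Count = FourNeighbours (Adj _ _) v w₁ w₂ w₃ w₄ a₁ a₂ a₃ a₄ only

  -- For m, n ≥ 3 the four neighbours are distinct, so exactly one of them is in S.
  exactlyOne⇒count : 3 ≤ suc m' → 3 ≤ suc n' → ∀ S → ExactlyOneNbrIn _ _ S v → Count.count S ≡ 1
  exactlyOne⇒count 3≤m 3≤n S = Count.exactlyOne⇒count S
    (λ e → wrap-suc≢pred x 3≤m (cong proj₁ e))
    (λ e → wrap-suc≢ x (<⇒≤ 3≤m) (cong proj₁ e))
    (λ e → wrap-suc≢ x (<⇒≤ 3≤m) (cong proj₁ e))
    (λ e → wrap-pred≢ x (<⇒≤ 3≤m) (cong proj₁ e))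
    (λ e → wrap-pred≢ x (<⇒≤ 3≤m) (cong proj₁ e))
    (λ e → wrap-suc≢pred y 3≤n (cong proj₂ e))

all-wrapped : ∀ {m' n'} (P : V (suc m') (suc n') → Set) → (∀ x y → P (wrap x , wrap y)) → ∀ u → P u
all-wrapped P h (a , b) = subst P (cong₂ _,_ (wrap-toℕ a) (wrap-toℕ b)) (h (toℕ a) (toℕ b))

tpc⇒exactlyOne : ∀ {m n} (S : V m n → Bool) → IsTPC m n S → ∀ v → ExactlyOneNbrIn m n S v
tpc⇒exactlyOne S (pds , inside) v with S v in e
... | true  = inside v e
... | false = pds v (not-¬ e)

EdgesIn₁ : (m n : ℕ) → (V m n → Bool) → Set
EdgesIn₁ m n S = ∀ u w → S u ≡ true → S w ≡ true → Adj m n u w → Adj₁ m n u w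

EdgesIn₂ : (m n : ℕ) → (V m n → Bool) → Set
EdgesIn₂ m n S = ∀ u w → S u ≡ true → S w ≡ true → Adj m n u w → Adj₂ m n u w

adj-transpose : ∀ {m n u w} → Adj m n u w → Adj n m (swap u) (swap w)
adj-transpose (inj₁ (adj , e)) = inj₂ (e , adj)
adj-transpose (inj₂ (e , adj)) = inj₁ (adj , e)

exactlyOne-transpose : ∀ {m n S v} → ExactlyOneNbrIn m n S v → ExactlyOneNbrIn n m (S ∘ swap) (swap v)
exactlyOne-transpose (u , s , adj , unique) =
  swap u , s , adj-transpose adj , λ w s' adj' → cong swap (unique (swap w) s' (adj-transpose adj'))

edges-transpose : ∀ {m n S} → EdgesIn₂ m n S → EdgesIn₁ n m (S ∘ swap)
edges-transpose vertical u w su sw adj = swap (vertical (swap u) (swap w) su sw (adj-transpose adj))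

-- Necessity, for a code with horizontal edges: its indicator on ℤ² satisfies the
-- hypotheses of HorizontalPairing.
module Necessity (m' n' : ℕ) (3≤m : 3 ≤ suc m') (3≤n : 3 ≤ suc n')
  (S : V (suc m') (suc n') → Bool)
  (exactlyOne : ∀ v → ExactlyOneNbrIn (suc m') (suc n') S v)
  (horizontal : EdgesIn₁ (suc m') (suc n') S) where

  F : ℕ → ℕ → ℕ
  F x y = χ (S (wrap x , wrap y))

  per-x : ∀ y → Periodic (suc m') (λ x → F x y)
  per-x y x = cong (λ z → χ (S (z , wrap y))) (wrap-periodic x)

  per-y : ∀ x → Periodic (suc n') (F x)
  per-y x y = cong (λ z → χ (S (wrap x , z))) (wrap-periodic y)

  one : ∀ x y → NeighbourSum F m' n' x y ≡ 1
  one x y = Around.exactlyOne⇒count m' n' x y 3≤m 3≤n S (exactlyOne (wrap x , wrap y))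

  -- A code vertex has no code neighbour in its column, so its partner is horizontal.
  paired : ∀ x y → F x y * (F (suc x) y + F (x + m') y) ≡ F x y
  paired x y with S (wrap x , wrap y) in e
  ... | false = refl
  ... | true  = trans (*-identityˡ _) (begin
    F (suc x) y + F (x + m') y               ≡⟨ sym (+-identityʳ _) ⟩
    F (suc x) y + F (x + m') y + (0 + 0)     ≡⟨ cong (F (suc x) y + F (x + m') y +_)
                                                     (sym (cong₂ _+_ (vertical-free a₃) (vertical-free a₄))) ⟩
    NeighbourSum F m' n' x y                 ≡⟨ one x y ⟩
    1                                        ∎)
    where
    open ≡-Reasoning
    open Around m' n' x y using (v; a₃; a₄)
    vertical-free : ∀ {b} → Adj _ _ v (wrap x , b) → χ (S (wrap x , b)) ≡ 0
    vertical-free {b} adj = χ-false (λ s → cyc-irrefl (<⇒≤ 3≤m) (proj₁ (horizontal v (wrap x , b) e s adj)))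

  divisibility : 4 ∣ suc m' × 4 ∣ suc n'
  divisibility = four-∣-m , four-∣-n
    where open HorizontalPairing F m' n' per-x per-y one paired using (four-∣-m; four-∣-n)

necessity : ∀ m' n' → 3 ≤ suc m' → 3 ≤ suc n' → HasPTPC (suc m') (suc n') → 4 ∣ suc m' × 4 ∣ suc n'
necessity m' n' 3≤m 3≤n (S , tpc , inj₁ horizontal) =
  Necessity.divisibility m' n' 3≤m 3≤n S (tpc⇒exactlyOne S tpc) horizontal
necessity m' n' 3≤m 3≤n (S , tpc , inj₂ vertical) = swap
  (Necessity.divisibility n' m' 3≤n 3≤m (S ∘ swap)
    (λ v → exactlyOne-transpose (tpc⇒exactlyOne S tpc (swap v))) (edges-transpose vertical))

-- Sufficiency: an explicit code when 4 ∣ m and 4 ∣ n.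

motif : ℕ → ℕ → Bool
motif 0 0 = true
motif 1 0 = true
motif 2 2 = true
motif 3 2 = true
motif _ _ = false

MotifCount : ℕ → ℕ → ℕ
MotifCount r s = (χ (motif (suc r % 4) s) + χ (motif ((r + 3) % 4) s))
                 + (χ (motif r (suc s % 4)) + χ (motif r ((s + 3) % 4)))

below-4 : ∀ {P : ℕ → Set} → P 0 → P 1 → P 2 → P 3 → ∀ r → r < 4 → P r
below-4 p₀ _  _  _  0 _ = p₀
below-4 _  p₁ _  _  1 _ = p₁
below-4 _  _  p₂ _  2 _ = p₂
below-4 _  _  _  p₃ 3 _ = p₃
below-4 _  _  _  _  (suc (suc (suc (suc _)))) (s≤s (s≤s (s≤s (s≤s ()))))

motif-count : ∀ r → r < 4 → ∀ s → s < 4 → MotifCount r s ≡ 1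
motif-count = below-4 (below-4 refl refl refl refl) (below-4 refl refl refl refl)
                        (below-4 refl refl refl refl) (below-4 refl refl refl refl)

motif-horizontal : ∀ r → r < 4 → ∀ s → s < 4 → motif r s ≡ true →
                     motif r (suc s % 4) ≡ false × motif r ((s + 3) % 4) ≡ false
motif-horizontal = below-4
  (below-4 (λ _ → refl , refl) (λ ()) (λ ()) (λ ()))
  (below-4 (λ _ → refl , refl) (λ ()) (λ ()) (λ ()))
  (below-4 (λ ()) (λ ()) (λ _ → refl , refl) (λ ()))
  (below-4 (λ ()) (λ ()) (λ _ → refl , refl) (λ ()))

wrap-%4 : ∀ {m'} → 4 ∣ suc m' → ∀ x → toℕ (wrap {m'} x) % 4 ≡ x % 4
wrap-%4 {m'} 4∣m x = trans (cong (_% 4) (toℕ-wrap x)) (m∣n⇒o%n%m≡o%m 4 (suc m') x 4∣m)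

pred-%4 : ∀ {m'} → 4 ∣ suc m' → ∀ x → (x + m') % 4 ≡ (x % 4 + 3) % 4
pred-%4 (divides zero ())
pred-%4 {m'} (divides (suc q) eq) x = begin
  (x + m') % 4              ≡⟨ cong (λ z → (x + z) % 4) (suc-injective eq) ⟩
  (x + (3 + q * 4)) % 4     ≡⟨ cong (_% 4) (sym (+-assoc x 3 (q * 4))) ⟩
  (x + 3 + q * 4) % 4       ≡⟨ [m+kn]%n≡m%n (x + 3) q 4 ⟩
  (x + 3) % 4               ≡⟨ %-distribˡ-+ x 3 4 ⟩
  (x % 4 + 3) % 4           ∎
  where open ≡-Reasoning

module Construction (m' n' : ℕ) (4∣m : 4 ∣ suc m') (4∣n : 4 ∣ suc n') where

  S : V (suc m') (suc n') → Bool
  S (a , b) = motif (toℕ a % 4) (toℕ b % 4)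

  S-wrap : ∀ x y → S (wrap x , wrap y) ≡ motif (x % 4) (y % 4)
  S-wrap x y = cong₂ motif (wrap-%4 4∣m x) (wrap-%4 4∣n y)

  exactlyOne : ∀ v → ExactlyOneNbrIn (suc m') (suc n') S v
  exactlyOne = all-wrapped (ExactlyOneNbrIn _ _ S) λ x y →
    Around.Count.count⇒exactlyOne m' n' x y S
      (trans (count-residues x y) (motif-count (x % 4) (m%n<n x 4) (y % 4) (m%n<n y 4)))
    where
    count-residues : ∀ x y → Around.Count.count m' n' x y S ≡ MotifCount (x % 4) (y % 4)
    count-residues x y = cong₄
      (cong χ (trans (S-wrap (suc x) y) (cong (λ z → motif z (y % 4)) (suc-% x 4))))
      (cong χ (trans (S-wrap (x + m') y) (cong (λ z → motif z (y % 4)) (pred-%4 4∣m x))))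
      (cong χ (trans (S-wrap x (suc y)) (cong (motif (x % 4)) (suc-% y 4))))
      (cong χ (trans (S-wrap x (y + n')) (cong (motif (x % 4)) (pred-%4 4∣n y))))

  horizontal : EdgesIn₁ (suc m') (suc n') S
  horizontal = all-wrapped (λ u → ∀ w → S u ≡ true → S w ≡ true → Adj _ _ u w → Adj₁ _ _ u w)
    λ x y w su sw adj → edge-at x y (motif-horizontal (x % 4) (m%n<n x 4) (y % 4) (m%n<n y 4)
                                       (trans (sym (S-wrap x y)) su)) w sw adj
    where
    edge-at : ∀ x y → motif (x % 4) (suc (y % 4) % 4) ≡ false × motif (x % 4) ((y % 4 + 3) % 4) ≡ false →
              ∀ w → S w ≡ true → Adj _ _ (wrap x , wrap y) w → Adj₁ _ _ (wrap x , wrap y) w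
    edge-at x y (above , below) w sw adj with Around.only m' n' x y w adj
    ... | inj₁ refl = follows⇒adj (wrap-follows x) , refl
    ... | inj₂ (inj₁ refl) = preceded⇒adj (wrap-preceded x) , refl
    ... | inj₂ (inj₂ (inj₁ refl)) with () ← trans (sym sw)
          (trans (S-wrap x (suc y)) (trans (cong (motif (x % 4)) (suc-% y 4)) above))
    ... | inj₂ (inj₂ (inj₂ refl)) with () ← trans (sym sw)
          (trans (S-wrap x (y + n')) (trans (cong (motif (x % 4)) (pred-%4 4∣n y)) below))

  code : HasPTPC (suc m') (suc n')
  code = S , ((λ v _ → exactlyOne v) , (λ v _ → exactlyOne v)) , inj₁ horizontal

corollary5 : (m n : ℕ) → 3 ≤ m → 3 ≤ n → HasPTPC m n ⇔ ((4 ∣ m) × (4 ∣ n))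
corollary5 zero     _        ()  _
corollary5 (suc _)  zero     _   ()
corollary5 (suc m') (suc n') 3≤m 3≤n =
  mk⇔ (necessity m' n' 3≤m 3≤n) (λ (4∣m , 4∣n) → Construction.code m' n' 4∣m 4∣n)
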